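{- Let $G$ be a finite almost simple group with socle $L$, let $U_1,\dots,U_r$ be subgroups of $G$, and assume that every coset of $L$ in $G$ contains an element which is fixed point free in each of the actions of $G$ on the cosets of $U_i$ ($i=1,\dots,r$). Then for every integer $k\ge 2$, every coset of $L^k$ in the wreath product $G\wr S_k=G^k\rtimes S_k$ contains an element which is fixed point free in each of the actions of $G\wr S_k$ on the cosets of $(U_i)^k\rtimes S_k$ ($i=1,\dots,r$).
   Context: $G\wr S_k=G^k\rtimes S_k$, where $S_k$ acts on $G^k$ by permuting the $k$ coordinates; $L^k$ and $(U_i)^k\rtimes S_k$ are the natural subgroups. -}

module Defs where

open import Level using (0ℓ)
open import Algebra.Bundles using (Group)
open import Data.Nat using (ℕ)
open import Data.Fin using (Fin)
open import Data.Fin.Permutation using (Permutation′; _⟨$⟩ʳ_; _⟨$⟩ˡ_; _∘ₚ_; flip)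
open import Data.Product using (Σ; ∃; _×_; _,_; proj₁; proj₂)
open import Data.Sum using (_⊎_)
open import Relation.Binary.PropositionalEquality using (_≡_)
open import Relation.Nullary using (¬_)
open import Relation.Unary using (Pred; _∈_; _⊆_)

-- aH = bH  iff  a⁻¹ b ∈ H
SameCoset : {A : Set} → (A → A → A) → (A → A) → Pred A 0ℓ → A → A → Set
SameCoset _·_ inv H a b = H (inv a · b)

FixesCoset : {A : Set} → (A → A → A) → (A → A) → Pred A 0ℓ → A → A → Set
FixesCoset _·_ inv H x y = SameCoset _·_ inv H (x · y) y

FixedPointFree : {A : Set} → (A → A → A) → (A → A) → Pred A 0ℓ → A → Set
FixedPointFree _·_ inv H x = ∀ y → ¬ FixesCoset _·_ inv H x y

module _ (G : Group 0ℓ 0ℓ) where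
  open Group G

  record Finite : Set where
    field
      size    : ℕ
      toFin   : Carrier → Fin size
      fromFin : Fin size → Carrier
      toFin-cong : ∀ {x y} → x ≈ y → toFin x ≡ toFin y
      from-to : ∀ x → fromFin (toFin x) ≈ x
      to-from : ∀ i → toFin (fromFin i) ≡ i

  record Subgroup : Set₁ where
    field
      mem      : Pred Carrier 0ℓ
      mem-resp : ∀ {x y} → x ≈ y → mem x → mem y
      ε-mem    : mem ε
      ∙-mem    : ∀ {x y} → mem x → mem y → mem (x ∙ y)
      ⁻¹-mem   : ∀ {x} → mem x → mem (x ⁻¹)
  open Subgroup public

  NormalisedBy : Subgroup → Subgroup → Set
  NormalisedBy N K = ∀ {g x} → mem K g → mem N x → mem N (g ⁻¹ ∙ (x ∙ g))

  IsNormal : Subgroup → Set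
  IsNormal N = ∀ g {x} → mem N x → mem N (g ⁻¹ ∙ (x ∙ g))

  IsTrivial : Subgroup → Set
  IsTrivial N = ∀ {x} → mem N x → x ≈ ε

  IsSimple : Subgroup → Set₁
  IsSimple L =
    (¬ IsTrivial L) ×
    (∀ (N : Subgroup) → mem N ⊆ mem L → NormalisedBy N L →
       IsTrivial N ⊎ (mem L ⊆ mem N))

  IsNonabelian : Subgroup → Set
  IsNonabelian L = ∃ λ x → ∃ λ y → mem L x × mem L y × ¬ (x ∙ y ≈ y ∙ x)

  TrivialCentraliser : Subgroup → Set
  TrivialCentraliser L = ∀ g → (∀ {x} → mem L x → g ∙ x ≈ x ∙ g) → g ≈ ε

  -- G is almost simple with socle L:  L is a nonabelian simple normal
  -- subgroup of G with C_G(L) = 1, i.e. L ≅ Inn(L) ≤ G ≤ Aut(L).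
  AlmostSimpleWithSocle : Subgroup → Set₁
  AlmostSimpleWithSocle L =
    IsNormal L × IsSimple L × IsNonabelian L × TrivialCentraliser L

-- S_k acts on G^k by (σ·f)(i) = f(σ⁻¹ i), and
--   (f , σ)(g , τ) = (f · (σ·g) , στ)   (στ = first τ, then σ)
--   (f , σ)⁻¹      = (σ⁻¹·f⁻¹ , σ⁻¹).

module _ (G : Group 0ℓ 0ℓ) (k : ℕ) where
  open Group G

  Wreath : Set
  Wreath = (Fin k → Carrier) × Permutation′ k

  _·W_ : Wreath → Wreath → Wreath
  (f , σ) ·W (g , τ) = (λ i → f i ∙ g (σ ⟨$⟩ˡ i)) , (τ ∘ₚ σ)

  invW : Wreath → Wreath
  invW (f , σ) = (λ i → f (σ ⟨$⟩ʳ i) ⁻¹) , flip σ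

  BasePower : Pred Carrier 0ℓ → Pred Wreath 0ℓ
  BasePower H (f , σ) = (∀ i → H (f i)) × (∀ i → σ ⟨$⟩ʳ i ≡ i)

  PowerSemidirect : Pred Carrier 0ℓ → Pred Wreath 0ℓ
  PowerSemidirect H (f , σ) = ∀ i → H (f i)

-- Write x = (f , σ) and pick a point p on a cycle p → σ⁻¹p → ⋯ → σ⁻ⁿp → p of σ⁻¹
-- (the orbit of p under j ↦ σ ⟨$⟩ˡ j), of minimal length n + 1.  If x fixes a coset
-- (g , τ)(Uᵏ ⋊ Sₖ), then coordinatewise f(j) g(σ⁻¹j) U = g(j) U, and telescoping these
-- relations around the cycle shows that the cycle product f(p) f(σ⁻¹p) ⋯ f(σ⁻ⁿp) fixes
-- the coset g(p)U.  So it suffices to make the cycle product fixed point free, which the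
-- hypothesis does after multiplying x by the element of Lᵏ that is l at p and 1 elsewhere:
-- by minimality this changes only the last factor of the cycle product, by l.
module Submission where

open import Defs
open import Level using (0ℓ)
open import Algebra.Bundles using (Group)
open import Data.Nat using (ℕ; zero; suc; _+_; _∸_; _≤_; _<_)
open import Data.Nat.Properties using (n<1+n; m<n⇒m<1+n; m∸n+n≡m; +-suc; anyUpTo?; ≤-refl)
open import Data.Nat.Induction using (<-rec)
open import Data.Nat.GeneralisedArithmetic using (fold; fold-+)
open import Data.Fin using (Fin; toℕ; _≟_)
open import Data.Fin.Patterns using (0F)
open import Data.Fin.Properties using (pigeonhole)
open import Data.Fin.Permutation using (Permutation′; _⟨$⟩ˡ_; _∘ₚ_)
import Data.Fin.Permutation as Permutation
open import Data.Vec.Functional using (updateAt)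
open import Data.Vec.Functional.Properties using (updateAt-updates; updateAt-minimal)
open import Data.Product using (∃; ∃₂; _×_; _,_; proj₂)
open import Function using (_∘_)
open import Relation.Binary.PropositionalEquality as ≡ using (_≡_; _≢_; cong; subst)
open import Relation.Nullary using (¬_; yes; no)
open import Relation.Unary using (Pred; Decidable)
import Algebra.Properties.Group as GroupProperties
import Relation.Binary.Reasoning.Setoid as SetoidReasoning

least-witness : {Q : Pred ℕ 0ℓ} → Decidable Q →
                ∀ d → Q d → ∃ λ m → Q m × (∀ {t} → t < m → ¬ Q t)
least-witness {Q} Q? = <-rec Goal step
  where
  Goal : Pred ℕ 0ℓ
  Goal d = Q d → ∃ λ m → Q m × (∀ {t} → t < m → ¬ Q t)
  step : ∀ d → (∀ {t} → t < d → Goal t) → Goal d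
  step d smaller Qd with anyUpTo? Q? d
  ... | yes (t , t<d , Qt) = smaller t<d Qt
  ... | no none            = d , Qd , λ t<d Qt → none (_ , t<d , Qt)

module _ {k : ℕ} (s : Fin (suc k) → Fin (suc k)) where

  ∃-periodicPoint : ∃₂ λ p d → fold p s (suc d) ≡ p
  ∃-periodicPoint with pigeonhole (n<1+n (suc k)) (fold 0F s ∘ toℕ)
  ... | i , j , i<j , sⁱ≡sʲ = fold 0F s (toℕ i) , d , (begin
      fold (fold 0F s (toℕ i)) s (suc d) ≡⟨ ≡.sym (fold-+ 0F s (suc d)) ⟩
      fold 0F s (suc d + toℕ i)          ≡⟨ cong (fold 0F s) d+i≡j ⟩
      fold 0F s (toℕ j)                  ≡⟨ ≡.sym sⁱ≡sʲ ⟩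
      fold 0F s (toℕ i)                  ∎)
    where
    open ≡.≡-Reasoning
    d = toℕ j ∸ suc (toℕ i)
    d+i≡j : suc d + toℕ i ≡ toℕ j
    d+i≡j = ≡.trans (≡.sym (+-suc d (toℕ i))) (m∸n+n≡m i<j)

  ∃-minimalPeriod : ∃₂ λ p n → fold p s (suc n) ≡ p × (∀ {t} → t < n → fold p s (suc t) ≢ p)
  ∃-minimalPeriod with ∃-periodicPoint
  ... | p , d , sᵈ⁺¹p≡p = p , least-witness (λ t → fold p s (suc t) ≟ p) d sᵈ⁺¹p≡p

module _ (G : Group 0ℓ 0ℓ) where
  open Group G
  open GroupProperties G using (⁻¹-anti-homo-∙; \\-leftDividesˡ; \\-leftDividesʳ)
  open SetoidReasoning setoid

  ∏ : (ℕ → Carrier) → ℕ → Carrier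
  ∏ c zero    = ε
  ∏ c (suc m) = ∏ c m ∙ c m

  ∏-cong< : ∀ {c d : ℕ → Carrier} m → (∀ {t} → t < m → c t ≈ d t) → ∏ c m ≈ ∏ d m
  ∏-cong< zero    c≈d = refl
  ∏-cong< (suc m) c≈d = ∙-cong (∏-cong< m (c≈d ∘ m<n⇒m<1+n)) (c≈d ≤-refl)

  module _ (V : Subgroup G) where

    _∼_ : Carrier → Carrier → Set
    _∼_ = SameCoset _∙_ _⁻¹ (mem V)

    ∼-reflexive : ∀ {a b} → a ≈ b → a ∼ b
    ∼-reflexive {a} {b} a≈b = mem-resp V (begin
      ε          ≈⟨ sym (inverseˡ b) ⟩
      b ⁻¹ ∙ b   ≈⟨ ∙-congʳ (⁻¹-cong (sym a≈b)) ⟩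
      a ⁻¹ ∙ b   ∎) (ε-mem V)

    ∼-trans : ∀ {a b c} → a ∼ b → b ∼ c → a ∼ c
    ∼-trans {a} {b} {c} a∼b b∼c = mem-resp V (begin
      (a ⁻¹ ∙ b) ∙ (b ⁻¹ ∙ c) ≈⟨ assoc _ _ _ ⟩
      a ⁻¹ ∙ (b ∙ (b ⁻¹ ∙ c)) ≈⟨ ∙-congˡ (\\-leftDividesˡ b c) ⟩
      a ⁻¹ ∙ c                ∎) (∙-mem V a∼b b∼c)

    ∼-respˡ : ∀ {a a′ b} → a ≈ a′ → a ∼ b → a′ ∼ b
    ∼-respˡ a≈a′ = mem-resp V (∙-congʳ (⁻¹-cong a≈a′))

    ∼-∙ˡ : ∀ c {a b} → a ∼ b → (c ∙ a) ∼ (c ∙ b)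
    ∼-∙ˡ c {a} {b} = mem-resp V (sym (begin
      (c ∙ a) ⁻¹ ∙ (c ∙ b)      ≈⟨ ∙-congʳ (⁻¹-anti-homo-∙ c a) ⟩
      (a ⁻¹ ∙ c ⁻¹) ∙ (c ∙ b)   ≈⟨ assoc _ _ _ ⟩
      a ⁻¹ ∙ (c ⁻¹ ∙ (c ∙ b))   ≈⟨ ∙-congˡ (\\-leftDividesʳ c b) ⟩
      a ⁻¹ ∙ b                  ∎))

    ∼-telescope : ∀ (a g : ℕ → Carrier) → (∀ t → (a t ∙ g (suc t)) ∼ g t) →
                  ∀ m → (∏ a m ∙ g m) ∼ g 0
    ∼-telescope a g step zero    = ∼-reflexive (identityˡ (g 0))
    ∼-telescope a g step (suc m) =
      ∼-trans (∼-respˡ (sym (assoc _ _ _)) (∼-∙ˡ (∏ a m) (step m))) (∼-telescope a g step m)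

    fixedPointFree-resp : ∀ {x y} → x ≈ y →
      FixedPointFree _∙_ _⁻¹ (mem V) x → FixedPointFree _∙_ _⁻¹ (mem V) y
    fixedPointFree-resp x≈y fpf z yz∼z = fpf z (∼-respˡ (∙-congʳ (sym x≈y)) yz∼z)

module _ (G : Group 0ℓ 0ℓ) {k : ℕ} where
  open Group G
  open SetoidReasoning setoid

  orbit : Permutation′ k → Fin k → ℕ → Fin k
  orbit σ p = fold p (σ ⟨$⟩ˡ_)

  cycleProduct : Wreath G k → Fin k → ℕ → Carrier
  cycleProduct (f , σ) p = ∏ G (f ∘ orbit σ p)

  module _ (V : Subgroup G) where

    fixesCoset⇒∼ : ∀ {a σ g τ} →
      FixesCoset (_·W_ G k) (invW G k) (PowerSemidirect G k (mem V)) (a , σ) (g , τ) →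
      ∀ j → _∼_ G V (a j ∙ g (σ ⟨$⟩ˡ j)) (g j)
    fixesCoset⇒∼ {a} {σ} {g} {τ} fixes j =
      subst (λ i → _∼_ G V (a i ∙ g (σ ⟨$⟩ˡ i)) (g i)) (Permutation.inverseʳ (τ ∘ₚ σ)) (fixes ((τ ∘ₚ σ) ⟨$⟩ˡ j))

    -- A coset (g , τ)(Vᵏ ⋊ Sₖ) fixed by x yields, by telescoping around the cycle,
    -- the coset g(p)V fixed by the cycle product.
    fixedPointFree-cycleProduct : ∀ x p n → orbit (proj₂ x) p (suc n) ≡ p →
      FixedPointFree _∙_ _⁻¹ (mem V) (cycleProduct x p (suc n)) →
      FixedPointFree (_·W_ G k) (invW G k) (PowerSemidirect G k (mem V)) x
    fixedPointFree-cycleProduct (a , σ) p n closed fpf (g , τ) fixes =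
      fpf (g p) (subst (λ q → _∼_ G V (cycleProduct (a , σ) p (suc n) ∙ g q) (g p)) closed
        (∼-telescope G V (a ∘ orbit σ p) (g ∘ orbit σ p) (fixesCoset⇒∼ {a} {σ} {g} {τ} fixes ∘ orbit σ p) (suc n)))

  single : Fin k → Carrier → Fin k → Carrier
  single p l = updateAt (λ _ → ε) p (λ _ → l)

  single-∈ : ∀ (P : Pred Carrier 0ℓ) p {l} → P ε → P l → ∀ j → P (single p l j)
  single-∈ P p Pε Pl j with j ≟ p
  ... | yes ≡.refl = subst P (≡.sym (updateAt-updates p _)) Pl
  ... | no j≢p   = subst P (≡.sym (updateAt-minimal j p _ j≢p)) Pε

  -- By minimality the cycle meets p only at its end.
  cycleProduct-·single : ∀ f σ p n l → orbit σ p (suc n) ≡ p →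
    (∀ {t} → t < n → orbit σ p (suc t) ≢ p) →
    cycleProduct (_·W_ G k (f , σ) (single p l , Permutation.id)) p (suc n) ≈ cycleProduct (f , σ) p (suc n) ∙ l
  cycleProduct-·single f σ p n l closed minimal = begin
    ∏ G (λ t → f (q t) ∙ h (q (suc t))) n ∙ (f (q n) ∙ h (q (suc n))) ≈⟨ ∙-cong (∏-cong< G n off-p) (∙-congˡ at-p) ⟩
    ∏ G (f ∘ q) n ∙ (f (q n) ∙ l)                                    ≈⟨ sym (assoc _ _ _) ⟩
    ∏ G (f ∘ q) n ∙ f (q n) ∙ l                                      ∎
    where
    q = orbit σ p
    h = single p l
    off-p : ∀ {t} → t < n → f (q t) ∙ h (q (suc t)) ≈ f (q t)
    off-p t<n = trans (∙-congˡ (reflexive (updateAt-minimal _ p _ (minimal t<n)))) (identityʳ _)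
    at-p : h (q (suc n)) ≈ l
    at-p = reflexive (≡.trans (cong h closed) (updateAt-updates p _))

lemma2p9 : (G : Group 0ℓ 0ℓ) → Finite G →
    (L : Subgroup G) → AlmostSimpleWithSocle G L →
    (r : ℕ) (U : Fin r → Subgroup G) →
    (∀ g → ∃ λ l → mem L l ×
       (∀ i → FixedPointFree (Group._∙_ G) (Group._⁻¹ G) (mem (U i)) (Group._∙_ G g l))) →
    ∀ (k : ℕ) → 2 ≤ k →
    ∀ (x : Wreath G k) → ∃ λ l → BasePower G k (mem L) l ×
       (∀ i → FixedPointFree (_·W_ G k) (invW G k) (PowerSemidirect G k (mem (U i))) (_·W_ G k x l))
lemma2p9 G _ L _ r U hyp (suc k) _ (f , σ)
  with p , n , closed , minimal ← ∃-minimalPeriod (σ ⟨$⟩ˡ_)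
  with l , l∈L , fpf ← hyp (cycleProduct G (f , σ) p (suc n))
  = h , (single-∈ G (mem L) p (ε-mem L) l∈L , λ _ → ≡.refl) , fixedPointFree
  where
  h : Wreath G (suc k)
  h = single G p l , Permutation.id

  fixedPointFree : ∀ i → FixedPointFree (_·W_ G (suc k)) (invW G (suc k))
                           (PowerSemidirect G (suc k) (mem (U i))) (_·W_ G (suc k) (f , σ) h)
  fixedPointFree i = fixedPointFree-cycleProduct G (U i) (_·W_ G (suc k) (f , σ) h) p n closed
    (fixedPointFree-resp G (U i) (Group.sym G (cycleProduct-·single G f σ p n l closed minimal)) (fpf i))
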